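{- Let $K$ be a $^*$-continuous KAT with top, $A$ a top Kleene abstract domain of $K$ with maps $\alpha,\gamma$, and $T_{\Sigma,B}$ a KAT language interpreted on $K$. Consider $\mathrm{LCTK}_A$ extended with the rule (limit), and let $t\in T_{\Sigma,B}$ be such that $A$ is globally complete for $\llbracket\mathtt b\rrbracket_u$ for every atom $\mathtt b$ occurring in $t$. For all $a,b\in K$, if $[a]\,t\,[b]$ is valid, i.e. $\top b\le\top a\llbracket t\rrbracket_u$ and $\mathcal S^\sharp[t]\,\alpha(\top a)=\alpha(\top b)=\alpha(\top a\llbracket t\rrbracket_u)$, then $[a]\,t\,[b]$ is derivable.
   Context: Idempotent semiring: $(K,+,0)$ commutative monoid with $a+a=a$, $(K,\cdot,1)$ monoid, two-sided distributivity, $0a=a0=0$; $a\le b$ iff $a+b=b$. KAT: idempotent semiring with Boolean subalgebra $\mathrm{Test}(K)$ (join $+$, meet $\cdot$, complement, bottom $0$, top $1$) and ${}^*$ with $1+aa^*\le a^*$, $1+a^*a\le a^*$, $b+ac\le c\Rightarrow a^*b\le c$, $b+ca\le c\Rightarrow ba^*\le c$. TopKAT: KAT with greatest element $\top$; $^*$-continuous: $\bigvee_nab^nc$ exists and equals $ab^*c$ for all $a,b,c$. $\mathrm{TOP}(K)=\{\top a\mid a\in K\}$. Language: disjoint $\Sigma,B$ ($\mathtt0,\mathtt1\in B$), $\mathrm{Atom}=\Sigma\cup B$, terms $t::=\mathtt a\mid\mathtt0\mid\mathtt1\mid t_1+t_2\mid t_1\cdot t_2\mid t^*$; evaluation $u:\mathrm{Atom}\to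 K$ with $u(B)\subseteq\mathrm{Test}(K)$, extended homomorphically to $\llbracket\cdot\rrbracket_u$. Top Kleene abstract domain: poset $A$, Galois insertion $\alpha:\mathrm{TOP}(K)\to A$, $\gamma:A\to\mathrm{TOP}(K)$ ($\alpha(x)\le_Ay\iff x\le\gamma(y)$, $\alpha\gamma=\mathrm{id}$), countably complete. Abstract semantics: $\mathcal S^\sharp[\mathtt c]x=\alpha(\gamma(x)\llbracket\mathtt c\rrbracket_u)$, $\mathcal S^\sharp[t_1+t_2]x=\mathcal S^\sharp[t_1]x\vee_A\mathcal S^\sharp[t_2]x$, $\mathcal S^\sharp[t_1\cdot t_2]x=\mathcal S^\sharp[t_2](\mathcal S^\sharp[t_1]x)$, $\mathcal S^\sharp[t^*]x=\bigvee_n(\mathcal S^\sharp[t])^nx$. $A(x):=\gamma\alpha(x)$ for $x\in\mathrm{TOP}(K)$. $\mathbb C^A_b(c)$ iff $A(\top bc)=A(A(\top b)c)$; $A$ is globally complete for $c$ iff $\mathbb C^A_b(c)$ for all $b\in K$. $\mathrm{LCTK}_A$ rules: (transfer) $\mathtt c\in\mathrm{Atom}$, $\mathbb C^A_a(\llbracket\mathtt c\rrbracket_u)$ $\vdash[a]\mathtt c[a\llbracket\mathtt c\rrbracket_u]$; (relax) $\top a'\le\top a\le A(\top a')$, $[a']t[b']$, $\top b\le\top b'\le A(\top b)$ $\vdash[a]t[b]$; (seq) $[a]t_1[r]$, $[r]t_2[b]$ $\vdash[a]t_1\cdot t_2[b]$; (join) $[a]t_1[b_1]$, $[a]t_2[b_2]$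 $\vdash[a]t_1+t_2[b_1+b_2]$; (rec) $[a]t[r]$, $[a+r]t^*[b]$ $\vdash[a]t^*[b]$; (iterate) $[a]t[b]$, $\top b\le A(\top a)$ $\vdash[a]t^*[a+b]$. Rule (limit): from $[a_n]t[a_{n+1}]$ for all $n\in\mathbb N$ infer $[a_0]t^*[\bigvee_na_n]$, applicable only when $\bigvee_na_n$ exists in $K$ and $\top\bigvee_na_n=\bigvee_n\top a_n$. -}

module Defs where

open import Data.Nat using (ℕ; zero; suc)
open import Data.Product using (Σ; ∃; _×_; _,_)
open import Data.Sum using (_⊎_; inj₁; inj₂)
open import Relation.Binary.PropositionalEquality using (_≡_)

record IsLub {X : Set} (_≼_ : X → X → Set) (f : ℕ → X) (s : X) : Set where
  field
    upper : ∀ n → f n ≼ s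
    least : ∀ y → (∀ n → f n ≼ y) → s ≼ y

-- KAT with top (equality of the carrier is propositional equality).
-- Order: a ≤ b  iff  a + b ≡ b  (written out inline inside the record).

record TopKAT : Set₁ where
  infixl 6 _+_
  infixl 7 _·_
  infix 8 _*
  field
    Carrier : Set
    _+_ _·_ : Carrier → Carrier → Carrier
    0# 1#   : Carrier
    _*      : Carrier → Carrier
    ⊤       : Carrier
    +-assoc     : ∀ a b c → (a + b) + c ≡ a + (b + c)
    +-comm      : ∀ a b → a + b ≡ b + a
    +-identityˡ : ∀ a → 0# + a ≡ a
    +-idem      : ∀ a → a + a ≡ a
    ·-assoc     : ∀ a b c → (a · b) · c ≡ a · (b · c)
    ·-identityˡ : ∀ a → 1# · a ≡ a
    ·-identityʳ : ∀ a → a · 1# ≡ a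
    distribˡ    : ∀ a b c → a · (b + c) ≡ a · b + a · c
    distribʳ    : ∀ a b c → (b + c) · a ≡ b · a + c · a
    zeroˡ       : ∀ a → 0# · a ≡ 0#
    zeroʳ       : ∀ a → a · 0# ≡ 0#
    Test        : Carrier → Set
    test-0      : Test 0#
    test-1      : Test 1#
    test-+      : ∀ {p q} → Test p → Test q → Test (p + q)
    test-·      : ∀ {p q} → Test p → Test q → Test (p · q)
    compl       : ∀ p → Test p → Carrier
    test-compl  : ∀ p (tp : Test p) → Test (compl p tp)
    compl-+     : ∀ p (tp : Test p) → p + compl p tp ≡ 1#
    compl-·     : ∀ p (tp : Test p) → p · compl p tp ≡ 0#
    test-·-comm : ∀ {p q} → Test p → Test q → p · q ≡ q · p
    test-·-idem : ∀ {p} → Test p → p · p ≡ p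
    test-absorb : ∀ {p q} → Test p → Test q → p + p · q ≡ p
    test-distrib : ∀ {p q r} → Test p → Test q → Test r →
                   p + q · r ≡ (p + q) · (p + r)
    *-unfoldˡ : ∀ a → (1# + a · a *) + a * ≡ a *
    *-unfoldʳ : ∀ a → (1# + a * · a) + a * ≡ a *
    *-inductˡ : ∀ a b c → (b + a · c) + c ≡ c → a * · b + c ≡ c
    *-inductʳ : ∀ a b c → (b + c · a) + c ≡ c → b · a * + c ≡ c
    ⊤-max : ∀ a → a + ⊤ ≡ ⊤

module KOps (K : TopKAT) where
  open TopKAT K

  infix 4 _≤_
  _≤_ : Carrier → Carrier → Set
  a ≤ b = a + b ≡ b

  pow : Carrier → ℕ → Carrier
  pow b zero    = 1#
  pow b (suc n) = b · pow b n

  InTOP : Carrier → Set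
  InTOP x = ∃ λ a → x ≡ ⊤ · a

StarContinuous : TopKAT → Set
StarContinuous K = ∀ a b c → IsLub _≤_ (λ n → a · pow b n · c) (a · b * · c)
  where open TopKAT K
        open KOps K

-- Top Kleene abstract domain: poset A, Galois insertion α ⊣ γ between
-- TOP(K) and A, A countably complete.  α is given as a function on the
-- whole carrier, but all its axioms (and all its uses) concern only
-- arguments of the form ⊤ · a, i.e. elements of TOP(K).

record TopKleeneAbsDomain (K : TopKAT) : Set₁ where
  open TopKAT K
  open KOps K
  field
    Abs        : Set
    _⊑_        : Abs → Abs → Set
    ⊑-refl     : ∀ x → x ⊑ x
    ⊑-trans    : ∀ {x y z} → x ⊑ y → y ⊑ z → x ⊑ z
    ⊑-antisym  : ∀ {x y} → x ⊑ y → y ⊑ x → x ≡ y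
    α          : Carrier → Abs
    γ          : Abs → Carrier
    γ-TOP      : ∀ y → InTOP (γ y)
    galois→    : ∀ a y → α (⊤ · a) ⊑ y → ⊤ · a ≤ γ y
    galois←    : ∀ a y → ⊤ · a ≤ γ y → α (⊤ · a) ⊑ y
    insertion  : ∀ y → α (γ y) ≡ y
    ⋁          : (ℕ → Abs) → Abs
    ⋁-lub      : ∀ f → IsLub _⊑_ f (⋁ f)

  _∨_ : Abs → Abs → Abs
  x ∨ y = ⋁ (λ { zero → x ; (suc _) → y })

-- KAT language: disjoint Σ and B (disjointness via ⊎), with 𝟘, 𝟙 ∈ B.

record Lang : Set₁ where
  field
    Sig : Set
    B   : Set
    𝟘 𝟙 : B

Atom : Lang → Set
Atom L = Lang.Sig L ⊎ Lang.B L

-- terms; the constants 0 and 1 are the atoms 𝟘, 𝟙 ∈ B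
data Term (L : Lang) : Set where
  atom : Atom L → Term L
  _⊕_  : Term L → Term L → Term L
  _⊙_  : Term L → Term L → Term L
  _⋆   : Term L → Term L

𝟘ₜ 𝟙ₜ : {L : Lang} → Term L
𝟘ₜ {L} = atom (inj₂ (Lang.𝟘 L))
𝟙ₜ {L} = atom (inj₂ (Lang.𝟙 L))

data Occurs {L : Lang} (c : Atom L) : Term L → Set where
  here  : Occurs c (atom c)
  ⊕ˡ    : ∀ {s t} → Occurs c s → Occurs c (s ⊕ t)
  ⊕ʳ    : ∀ {s t} → Occurs c t → Occurs c (s ⊕ t)
  ⊙ˡ    : ∀ {s t} → Occurs c s → Occurs c (s ⊙ t)
  ⊙ʳ    : ∀ {s t} → Occurs c t → Occurs c (s ⊙ t)
  ⋆⁺    : ∀ {s} → Occurs c s → Occurs c (s ⋆)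

record Interp (K : TopKAT) (L : Lang) : Set where
  open TopKAT K
  field
    u      : Atom L → Carrier
    u-test : ∀ b → Test (u (inj₂ b))
    u-𝟘    : u (inj₂ (Lang.𝟘 L)) ≡ 0#
    u-𝟙    : u (inj₂ (Lang.𝟙 L)) ≡ 1#

module Semantics (K : TopKAT) (D : TopKleeneAbsDomain K)
                 {L : Lang} (I : Interp K L) where
  open TopKAT K
  open KOps K
  open TopKleeneAbsDomain D
  open Interp I

  ⟦_⟧ : Term L → Carrier
  ⟦ atom c ⟧ = u c
  ⟦ s ⊕ t ⟧  = ⟦ s ⟧ + ⟦ t ⟧
  ⟦ s ⊙ t ⟧  = ⟦ s ⟧ · ⟦ t ⟧
  ⟦ t ⋆ ⟧    = ⟦ t ⟧ *

  iter : (Abs → Abs) → ℕ → Abs → Abs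
  iter f zero    x = x
  iter f (suc n) x = f (iter f n x)

  S♯ : Term L → Abs → Abs
  S♯ (atom c) x = α (γ x · u c)
  S♯ (s ⊕ t)  x = S♯ s x ∨ S♯ t x
  S♯ (s ⊙ t)  x = S♯ t (S♯ s x)
  S♯ (t ⋆)    x = ⋁ (λ n → iter (S♯ t) n x)

  Acl : Carrier → Carrier
  Acl x = γ (α x)

  Compl : Carrier → Carrier → Set
  Compl b c = Acl (⊤ · b · c) ≡ Acl (Acl (⊤ · b) · c)

  GloballyComplete : Carrier → Set
  GloballyComplete c = ∀ b → Compl b c

  data Derivable : Carrier → Term L → Carrier → Set where
    transfer : ∀ {a} (c : Atom L) → Compl a (u c) →
               Derivable a (atom c) (a · u c)
    relax    : ∀ {a a' b b' t} →
               ⊤ · a' ≤ ⊤ · a → ⊤ · a ≤ Acl (⊤ · a') →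
               Derivable a' t b' →
               ⊤ · b ≤ ⊤ · b' → ⊤ · b' ≤ Acl (⊤ · b) →
               Derivable a t b
    seq      : ∀ {a r b t₁ t₂} → Derivable a t₁ r → Derivable r t₂ b →
               Derivable a (t₁ ⊙ t₂) b
    join     : ∀ {a b₁ b₂ t₁ t₂} → Derivable a t₁ b₁ → Derivable a t₂ b₂ →
               Derivable a (t₁ ⊕ t₂) (b₁ + b₂)
    rec      : ∀ {a r b t} → Derivable a t r → Derivable (a + r) (t ⋆) b →
               Derivable a (t ⋆) b
    iterate  : ∀ {a b t} → Derivable a t b → ⊤ · b ≤ Acl (⊤ · a) →
               Derivable a (t ⋆) (a + b)
    limit    : ∀ {t} (as : ℕ → Carrier) (s : Carrier) →
               (∀ n → Derivable (as n) t (as (suc n))) →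
               IsLub _≤_ as s →
               IsLub _≤_ (λ n → ⊤ · as n) (⊤ · s) →
               Derivable (as zero) (t ⋆) s

  Valid : Carrier → Term L → Carrier → Set
  Valid a t b = (⊤ · b ≤ ⊤ · a · ⟦ t ⟧)
              × (S♯ t (α (⊤ · a)) ≡ α (⊤ · b))
              × (α (⊤ · b) ≡ α (⊤ · a · ⟦ t ⟧))

{-# OPTIONS --safe #-}
-- Completeness of A for every atom lets (transfer) derive [a] c [a⟦c⟧], and the
-- compositional rules then derive the strongest postcondition [a] t [a⟦t⟧] for
-- every t: a star is handled by (limit) on the chain aⁿ = a⟦t⟧ⁿ, whose join
-- a⟦t⟧* is preserved by ⊤ · _ thanks to *-continuity. Validity says that b lies
-- below a⟦t⟧ under ⊤ and has the same abstraction, so (relax) weakens the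
-- strongest postcondition to b.
module Submission where

open import Defs
open import Data.Nat using (ℕ; zero; suc)
open import Data.Product using (_,_)
open import Function using (_∘_)
open import Relation.Binary.PropositionalEquality

IsLub-cong : ∀ {X : Set} {_≼_ : X → X → Set} {f g : ℕ → X} {s s' : X} →
             (∀ n → f n ≡ g n) → s ≡ s' → IsLub _≼_ f s → IsLub _≼_ g s'
IsLub-cong {_≼_ = _≼_} {s = s} f≡g refl lub = record
  { upper = λ n → subst (_≼ s) (f≡g n) (IsLub.upper lub n)
  ; least = λ y g≼y → IsLub.least lub y (λ n → subst (_≼ y) (sym (f≡g n)) (g≼y n))
  }

module _ (K : TopKAT) where
  open TopKAT K
  open KOps K

  pow-·-comm : ∀ x n → pow x n · x ≡ x · pow x n
  pow-·-comm x zero    = trans (·-identityˡ x) (sym (·-identityʳ x))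
  pow-·-comm x (suc n) = trans (·-assoc x (pow x n) x) (cong (x ·_) (pow-·-comm x n))

  pow-suc-·ˡ : ∀ a x n → (a · pow x n) · x ≡ a · pow x (suc n)
  pow-suc-·ˡ a x n = trans (·-assoc a (pow x n) x) (cong (a ·_) (pow-·-comm x n))

  module _ (sc : StarContinuous K) where

    star-lub : ∀ a x → IsLub _≤_ (λ n → a · pow x n) (a · x *)
    star-lub a x = IsLub-cong (λ n → ·-identityʳ _) (·-identityʳ _) (sc a x 1#)

    ⊤·-star-lub : ∀ a x → IsLub _≤_ (λ n → ⊤ · (a · pow x n)) (⊤ · (a · x *))
    ⊤·-star-lub a x =
      IsLub-cong (λ n → ·-assoc ⊤ a (pow x n)) (·-assoc ⊤ a (x *)) (star-lub (⊤ · a) x)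

module _ (K : TopKAT) (D : TopKleeneAbsDomain K) {L : Lang} (I : Interp K L) where
  open TopKAT K
  open KOps K
  open TopKleeneAbsDomain D
  open Interp I
  open Semantics K D I

  Acl-extensive : ∀ a → ⊤ · a ≤ Acl (⊤ · a)
  Acl-extensive a = galois→ a (α (⊤ · a)) (⊑-refl _)

  relax-post : ∀ {a b b' t} → Derivable a t b' →
               ⊤ · b ≤ ⊤ · b' → α (⊤ · b) ≡ α (⊤ · b') → Derivable a t b
  relax-post {a} {b} {b'} d b≤b' αb≡αb' =
    relax (+-idem (⊤ · a)) (Acl-extensive a) d b≤b'
      (subst (λ z → ⊤ · b' ≤ γ z) (sym αb≡αb') (Acl-extensive b'))

  derivable-strongest : StarContinuous K → ∀ t →
                        (∀ c → Occurs c t → GloballyComplete (u c)) →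
                        ∀ a → Derivable a t (a · ⟦ t ⟧)
  derivable-strongest sc (atom c) complete a = transfer c (complete c here a)
  derivable-strongest sc (s ⊕ t) complete a =
    subst (Derivable a (s ⊕ t)) (sym (distribˡ a ⟦ s ⟧ ⟦ t ⟧))
      (join (derivable-strongest sc s (λ c → complete c ∘ ⊕ˡ) a)
            (derivable-strongest sc t (λ c → complete c ∘ ⊕ʳ) a))
  derivable-strongest sc (s ⊙ t) complete a =
    subst (Derivable a (s ⊙ t)) (·-assoc a ⟦ s ⟧ ⟦ t ⟧)
      (seq (derivable-strongest sc s (λ c → complete c ∘ ⊙ˡ) a)
           (derivable-strongest sc t (λ c → complete c ∘ ⊙ʳ) (a · ⟦ s ⟧)))
  derivable-strongest sc (t ⋆) complete a =
    subst (λ a₀ → Derivable a₀ (t ⋆) (a · ⟦ t ⟧ *)) (·-identityʳ a)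
      (limit chain (a · ⟦ t ⟧ *) chain-step
             (star-lub K sc a ⟦ t ⟧) (⊤·-star-lub K sc a ⟦ t ⟧))
    where
      chain : ℕ → Carrier
      chain n = a · pow ⟦ t ⟧ n

      chain-step : ∀ n → Derivable (chain n) t (chain (suc n))
      chain-step n =
        subst (Derivable (chain n) t) (pow-suc-·ˡ K a ⟦ t ⟧ n)
          (derivable-strongest sc t (λ c → complete c ∘ ⋆⁺) (chain n))

theorem10 : (K : TopKAT) → StarContinuous K →
            (D : TopKleeneAbsDomain K) →
            (L : Lang) (I : Interp K L) (t : Term L) →
            (∀ c → Occurs c t →
               Semantics.GloballyComplete K D I (Interp.u I c)) →
            ∀ a b → Semantics.Valid K D I a t b →
            Semantics.Derivable K D I a t b
theorem10 K sc D L I t complete a b (b≤at , _ , αb≡αat) =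
  relax-post K D I (derivable-strongest K D I sc t complete a)
    (subst (⊤ · b ≤_) (·-assoc ⊤ a ⟦ t ⟧) b≤at)
    (trans αb≡αat (cong α (·-assoc ⊤ a ⟦ t ⟧)))
  where
    open TopKAT K
    open KOps K
    open TopKleeneAbsDomain D
    open Semantics K D I
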